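{- Let $\langle X,\tau^0,\tau^1\rangle$ be any bitopological space. The following are equivalent: (1) $\langle X,\tau^0\rangle$ is scattered and both $\tau^0$ and $\tau^1$ are Alexandroff; (2) there exists a Visser frame $\langle X,R,S\rangle$ such that $\tau^0=\tau_R$ and $\tau^1=\tau_S$.
   Context: A bitopological space is $\langle X,\tau^0,\tau^1\rangle$ with $X\neq\varnothing$ and $\tau^0,\tau^1$ topologies on $X$. For a topology $\tau$, $d_\tau(Y)=\{x: \text{every } U\in\tau \text{ containing } x \text{ meets } Y\setminus\{x\}\}$; $\langle X,\tau\rangle$ is scattered if $Y\setminus d_\tau(Y)\ne\varnothing$ for every nonempty $Y\subseteq X$; $\tau$ is Alexandroff if it is closed under arbitrary intersections. A Visser frame is $\langle W,R,S\rangle$ with $W\neq\varnothing$, $R$ a transitive and conversely well-founded binary relation on $W$ (no infinite sequence $x_0Rx_1Rx_2\cdots$), and $S$ a transitive reflexive binary relation on $W$. For a binary relation $P$ on $W$, $\tau_P$ is the family of $P$-upward closed subsets of $W$ (sets $Y$ with $x\in Y$, $xPy\Rightarrow y\in Y$). -}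

module Defs where

open import Level using (Level) renaming (suc to lsuc)
open import Data.Nat using (ℕ; suc)
open import Data.Product using (Σ; _×_; _,_; ∃)
open import Data.Empty using (⊥)
open import Data.Unit using (⊤)
open import Relation.Nullary using (¬_)
open import Relation.Binary.PropositionalEquality using (_≢_)
open import Function.Bundles using (_⇔_)

Subset : Set → Set₁
Subset X = X → Set

-- Families of subsets are indexed by arbitrary types in Set₁ (large enough to
-- index any collection of subsets of X, e.g. all opens).  Unions/intersections
-- are stated extensionally: any subset pointwise equivalent to the union
-- (intersection) belongs to τ.
record IsTopology {X : Set} (τ : Subset X → Set) : Set₂ where
  field
    empty-open : τ (λ _ → ⊥)
    full-open  : τ (λ _ → ⊤)
    inter-open : ∀ {U V} → τ U → τ V → τ (λ x → U x × V x)
    union-open : (I : Set₁) (U : I → Subset X) → (∀ i → τ (U i)) →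
                 (V : Subset X) → (∀ x → V x ⇔ Σ I (λ i → U i x)) → τ V

IsAlexandroff : {X : Set} → (Subset X → Set) → Set₂
IsAlexandroff {X} τ =
  (I : Set₁) (U : I → Subset X) → (∀ i → τ (U i)) →
  (V : Subset X) → (∀ x → V x ⇔ ((i : I) → U i x)) → τ V

d : {X : Set} → (Subset X → Set) → Subset X → X → Set₁
d {X} τ Y x = (U : Subset X) → τ U → U x → Σ X (λ y → U y × Y y × y ≢ x)

Scattered : {X : Set} → (Subset X → Set) → Set₁
Scattered {X} τ = (Y : Subset X) → Σ X Y → ¬ ((x : X) → Y x → d τ Y x)

τ[_] : {X : Set} → (X → X → Set) → Subset X → Set
τ[_] {X} P Y = {x y : X} → Y x → P x y → Y y

_≗τ_ : {X : Set} → (Subset X → Set) → (Subset X → Set) → Set₁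
_≗τ_ {X} σ τ = (Y : Subset X) → σ Y ⇔ τ Y

ConverselyWellFounded : {X : Set} → (X → X → Set) → Set
ConverselyWellFounded {X} R = ¬ Σ (ℕ → X) (λ f → (n : ℕ) → R (f n) (f (suc n)))

-- Visser frame ⟨X, R, S⟩ (X nonempty is a separate hypothesis).
record IsVisserFrame {X : Set} (R S : X → X → Set) : Set where
  field
    R-trans : ∀ {x y z} → R x y → R y z → R x z
    R-cwf   : ConverselyWellFounded R
    S-trans : ∀ {x y z} → S x y → S y z → S x z
    S-refl  : ∀ {x} → S x x

module Submission where

-- An Alexandroff topology is exactly the family of upsets of its specialisation
-- preorder x ⊑ y (every open containing x contains y): the up-set of x is the
-- intersection of the opens containing x.  A set in which every point has a
-- strictly ⊑-larger point is contained in its derived set, so when τ⁰ is scattered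
-- ⊑ is antisymmetric (take a pair {x, y}) and its strict part admits no infinite
-- ascending chain (take the chain's image); the strict part of τ⁰'s preorder and
-- τ¹'s preorder thus form a Visser frame.  Conversely, upsets are closed under
-- intersections, and in a nonempty Y ⊆ d(Y) every point x has an R-successor in Y,
-- since {x} ∪ R[x] is open; iterating yields an infinite R-chain.

open import Defs
open import Axiom.ExcludedMiddle using (ExcludedMiddle)
open import Data.Product using (Σ; _×_; _,_; proj₁; proj₂)
open import Data.Sum using (_⊎_; inj₁; inj₂)
open import Data.Nat using (ℕ; zero; suc)
open import Data.Empty using (⊥; ⊥-elim)
open import Function.Bundles using (_⇔_; mk⇔; Equivalence)
open import Function.Properties.Equivalence using () renaming (trans to ⇔-trans)
open import Level using (Level; Lift; lift; lower; 0ℓ) renaming (suc to lsuc)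
open import Relation.Binary.Definitions using (Transitive)
open import Relation.Binary.PropositionalEquality using (_≡_; refl; sym; _≢_)
open import Relation.Nullary using (yes; no)
open import Relation.Nullary.Decidable using (True; toWitness; fromWitness)
open import Relation.Unary using (_⊆′_)

module _ {X : Set} where

  upsets-alexandroff : {τ : Subset X → Set} (P : X → X → Set) →
                       τ ≗τ τ[ P ] → IsAlexandroff τ
  upsets-alexandroff P τ≗ I U U-open V V≐⋂U =
    Equivalence.from (τ≗ V) λ {x} {y} Vx Pxy →
      Equivalence.from (V≐⋂U y) λ i →
        Equivalence.to (τ≗ (U i)) (U-open i) (Equivalence.to (V≐⋂U x) Vx i) Pxy

  ↑_∪｛_｝ : (X → X → Set) → X → Subset X
  (↑ R ∪｛ x ｝) y = y ≡ x ⊎ R x y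

  ↑∪｛｝-upset : {R : X → X → Set} → Transitive R → ∀ x → τ[ R ] (↑ R ∪｛ x ｝)
  ↑∪｛｝-upset R-trans x (inj₁ refl) Rxy = inj₂ Rxy
  ↑∪｛｝-upset R-trans x (inj₂ Rx′x) Rxy = inj₂ (R-trans Rx′x Rxy)

  successors⇒chain : {R : X → X → Set} {Y : Subset X} →
                     ((p : Σ X Y) → Σ (Σ X Y) λ q → R (proj₁ p) (proj₁ q)) →
                     Σ X Y → Σ (ℕ → X) λ f → ∀ n → R (f n) (f (suc n))
  successors⇒chain {Y = Y} next start = (λ n → proj₁ (iterate n)) , λ n → proj₂ (next (iterate n))
    where
    iterate : ℕ → Σ X Y
    iterate zero    = start
    iterate (suc n) = proj₁ (next (iterate n))

  upsets-scattered : {τ : Subset X → Set} (R : X → X → Set) → Transitive R →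
                     ConverselyWellFounded R → τ ≗τ τ[ R ] → Scattered τ
  upsets-scattered R R-trans R-cwf τ≗ Y Y≢∅ Y⊆dY = R-cwf (successors⇒chain next Y≢∅)
    where
    next : (p : Σ X Y) → Σ (Σ X Y) λ q → R (proj₁ p) (proj₁ q)
    next (x , Yx)
      with Y⊆dY x Yx (↑ R ∪｛ x ｝) (Equivalence.from (τ≗ _) (↑∪｛｝-upset R-trans x)) (inj₁ refl)
    ... | y , inj₁ y≡x , _  , y≢x = ⊥-elim (y≢x y≡x)
    ... | y , inj₂ Rxy , Yy , _   = (y , Yy) , Rxy

module Specialisation (em : {ℓ : Level} → ExcludedMiddle ℓ) {X : Set} where

  -- The specialisation preorder quantifies over all subsets, hence lives in Set₁;
  -- excluded middle lets us squash it into a relation X → X → Set.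
  _⊑[_]_ : X → (Subset X → Set) → X → Set
  x ⊑[ τ ] y = True (em {P = (U : Subset X) → τ U → U x → U y})

  _⊏[_]_ : X → (Subset X → Set) → X → Set
  x ⊏[ τ ] y = x ⊑[ τ ] y × x ≢ y

  module _ {τ : Subset X → Set} where

    specialise : ∀ {x y} → x ⊑[ τ ] y → (U : Subset X) → τ U → U x → U y
    specialise = toWitness

    ⊑-intro : ∀ {x y} → ((U : Subset X) → τ U → U x → U y) → x ⊑[ τ ] y
    ⊑-intro = fromWitness

    ⊑-refl : ∀ {x} → x ⊑[ τ ] x
    ⊑-refl = ⊑-intro λ _ _ Ux → Ux

    ⊑-trans : Transitive (_⊑[ τ ]_)
    ⊑-trans x⊑y y⊑z = ⊑-intro λ U U-open Ux → specialise y⊑z U U-open (specialise x⊑y U U-open Ux)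

    open⇒⊑-upset : (U : Subset X) → τ U → τ[ _⊑[ τ ]_ ] U
    open⇒⊑-upset U U-open Ux x⊑y = specialise x⊑y U U-open Ux

    ⊑-upset-open : IsAlexandroff τ → ∀ x → τ (x ⊑[ τ ]_)
    ⊑-upset-open alex x =
      alex (Σ (Subset X) λ U → τ U × U x) proj₁ (λ (_ , U-open , _) → U-open) (x ⊑[ τ ]_)
        λ y → mk⇔ (λ x⊑y (U , U-open , Ux) → specialise x⊑y U U-open Ux)
                  (λ y∈⋂ → ⊑-intro λ U U-open Ux → y∈⋂ (U , U-open , Ux))

    ⊑-upset⇒open : IsTopology τ → IsAlexandroff τ → (U : Subset X) → τ[ _⊑[ τ ]_ ] U → τ U
    ⊑-upset⇒open top alex U U-upset =
      IsTopology.union-open top (Lift (lsuc 0ℓ) (Σ X U)) (λ i → proj₁ (lower i) ⊑[ τ ]_)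
        (λ i → ⊑-upset-open alex (proj₁ (lower i))) U
        λ y → mk⇔ (λ Uy → lift (y , Uy) , ⊑-refl) (λ (lift (_ , Ux) , x⊑y) → U-upset Ux x⊑y)

    alexandroff-≗τ-⊑ : IsTopology τ → IsAlexandroff τ → τ ≗τ τ[ _⊑[ τ ]_ ]
    alexandroff-≗τ-⊑ top alex U = mk⇔ (open⇒⊑-upset U) (⊑-upset⇒open top alex U)

    strict-successors⇒⊆d : {Y : Subset X} →
                           (∀ x → Y x → Σ X λ y → Y y × x ⊏[ τ ] y) → Y ⊆′ d τ Y
    strict-successors⇒⊆d next x Yx U U-open Ux with next x Yx
    ... | y , Yy , x⊑y , x≢y = y , specialise x⊑y U U-open Ux , Yy , λ y≡x → x≢y (sym y≡x)

    scattered⇒⊑-antisym : Scattered τ → ∀ {x y} → x ⊑[ τ ] y → y ⊑[ τ ] x → x ≢ y → ⊥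
    scattered⇒⊑-antisym scat {x} {y} x⊑y y⊑x x≢y =
      scat pair (x , inj₁ refl) (strict-successors⇒⊆d next)
      where
      pair : Subset X
      pair z = z ≡ x ⊎ z ≡ y
      next : ∀ z → pair z → Σ X λ w → pair w × z ⊏[ τ ] w
      next _ (inj₁ refl) = y , inj₂ refl , x⊑y , x≢y
      next _ (inj₂ refl) = x , inj₁ refl , y⊑x , λ y≡x → x≢y (sym y≡x)

    scattered⇒⊏-trans : Scattered τ → Transitive (_⊏[ τ ]_)
    scattered⇒⊏-trans scat (x⊑y , x≢y) (y⊑z , _) =
      ⊑-trans x⊑y y⊑z , λ { refl → scattered⇒⊑-antisym scat x⊑y y⊑z x≢y }

    scattered⇒⊏-cwf : Scattered τ → ConverselyWellFounded (_⊏[ τ ]_)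
    scattered⇒⊏-cwf scat (f , chain) =
      scat image (f 0 , 0 , refl) (strict-successors⇒⊆d next)
      where
      image : Subset X
      image z = Σ ℕ λ n → f n ≡ z
      next : ∀ z → image z → Σ X λ w → image w × z ⊏[ τ ] w
      next _ (n , refl) = f (suc n) , (suc n , refl) , chain n

  upsets-strict-part : (P : X → X → Set) (U : Subset X) →
                       τ[ P ] U ⇔ τ[ (λ x y → P x y × x ≢ y) ] U
  upsets-strict-part P U = mk⇔ (λ U-upset {_} {_} Ux (Pxy , _) → U-upset Ux Pxy) from
    where
    from : τ[ (λ x y → P x y × x ≢ y) ] U → τ[ P ] U
    from U-upset {x} {y} Ux Pxy with em {P = x ≡ y}
    ... | yes refl = Ux
    ... | no x≢y   = U-upset Ux (Pxy , x≢y)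

theorem3p8 : ({ℓ : _} → ExcludedMiddle ℓ) →
    {X : Set} → X → (τ0 τ1 : Subset X → Set) → IsTopology τ0 → IsTopology τ1 →
    (Scattered τ0 × IsAlexandroff τ0 × IsAlexandroff τ1) ⇔
    Σ (X → X → Set) (λ R → Σ (X → X → Set) (λ S →
    IsVisserFrame R S × (τ0 ≗τ τ[ R ]) × (τ1 ≗τ τ[ S ])))
theorem3p8 em {X} _ τ0 τ1 top0 top1 = mk⇔ to from
  where
  to : Scattered τ0 × IsAlexandroff τ0 × IsAlexandroff τ1 →
       Σ (X → X → Set) λ R → Σ (X → X → Set) λ S →
       IsVisserFrame R S × (τ0 ≗τ τ[ R ]) × (τ1 ≗τ τ[ S ])
  to (scat , alex0 , alex1) =
    _⊏[ τ0 ]_ , _⊑[ τ1 ]_ ,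
    record { R-trans = scattered⇒⊏-trans scat
           ; R-cwf   = scattered⇒⊏-cwf scat
           ; S-trans = ⊑-trans
           ; S-refl  = ⊑-refl } ,
    (λ U → ⇔-trans (alexandroff-≗τ-⊑ top0 alex0 U) (upsets-strict-part _⊑[ τ0 ]_ U)) ,
    alexandroff-≗τ-⊑ top1 alex1
    where open Specialisation em

  from : (Σ (X → X → Set) λ R → Σ (X → X → Set) λ S →
          IsVisserFrame R S × (τ0 ≗τ τ[ R ]) × (τ1 ≗τ τ[ S ])) →
         Scattered τ0 × IsAlexandroff τ0 × IsAlexandroff τ1
  from (R , S , frame , τ0≗ , τ1≗) =
    upsets-scattered R R-trans R-cwf τ0≗ , upsets-alexandroff R τ0≗ , upsets-alexandroff S τ1≗
    where open IsVisserFrame frame
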